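{- Let $N_1,N_2$ be labeled Petri nets, $C_1,C_2$ Presburger formulas over the places of $N_1$ and $N_2$ respectively, and $E$ a Presburger formula with free variables in $P_1\cup P_2$. For $i=1,2$ let $\tau^*_{C_i}$ be a Presburger formula such that for every marking $m\models C_i$ of $N_i$ and every marking $m'$ of $N_i$, $\tau^*_{C_i}(m,m')$ holds iff $m\xRightarrow{\epsilon}m'$ in $N_i$. Suppose that: (Core 0) for each $i\in\{1,2\}$ the formula $\forall\vec p,\vec p',a.\ C_i(\vec p)\wedge\overleftarrow{T}_{C_i}(\vec p,\vec p',a)\implies\exists\vec p''.\ C_i(\vec p'')\wedge\overleftarrow{T}_{C_i}(\vec p,\vec p'',a)\wedge\tau^*_{C_i}(\vec p'',\vec p')$ (built from $N_i$) is valid; (Core 1) $\forall\vec x.\ C_1(\vec x)\implies\exists\vec y.\ \tilde E(\vec x,\vec y)\wedge C_2(\vec y)$ is valid; (Core 2) $\forall\vec p_1,\vec p_2,\vec p_1'.\ \tilde E(\vec p_1,\vec p_2)\wedge\tau_1(\vec p_1,\vec p_1')\implies\tilde E(\vec p_1',\vec p_2)$ is valid; (Core 3) $\forall\vec p_1,\vec p_2,a,\vec p_1',\vec p_2'.\ C_1(\vec p_1)\wedge\tilde E(\vec p_1,\vec p_2)\wedge C_2(\vec p_2)\wedge\hat T_{C_1}(\vec p_1,\vec p_1',a)\wedge\tilde E(\vec p_1',\vec p_2')\implies\hat T_{C_2}(\vec p_2,\vec p_2',a)$ is valid. Then $(N_1,C_1)$ and $(N_2,C_2)$ are coherent nets and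 $(N_1,C_1)\preceq_E(N_2,C_2)$.
   Context: A labeled Petri net $N=(P,T,\mathrm{Pre},\mathrm{Post})$ has finite place set $P=\{p_1,\dots,p_n\}$, finite transition set $T$, $\mathrm{Pre},\mathrm{Post}:T\to(P\to\mathbb N)$, and labeling $l:T\to\Sigma\cup\{\tau\}$, $\tau$ silent. Labels are encoded as natural numbers: $\Sigma\subseteq\mathbb N\setminus\{0\}$, $\tau$ encoded by $0$. Markings $m:P\to\mathbb N$ are identified with vectors. $t$ is enabled at $m$ if $m\ge\mathrm{Pre}(t)$, and then $m\xrightarrow{t}m'$ with $m'=m-\mathrm{Pre}(t)+\mathrm{Post}(t)$; $m\xRightarrow{\varrho}m'$ is firing along $\varrho\in T^*$. Extend $l$ to $T^*$ by erasing $\tau$. For $\sigma\in\Sigma^*$, $m\xRightarrow{\sigma}m'$ means some $\varrho$ with $l(\varrho)=\sigma$ has $m\xRightarrow{\varrho}m'$ ($m\xRightarrow{\epsilon}m'$: silent reachability). $m\overset{\epsilon}{\twoheadrightarrow}m'$ iff $m=m'$; for $\sigma\in\Sigma^*,a\in\Sigma$, $m\overset{\sigma a}{\twoheadrightarrow}m'$ iff there exist $m''$, $t$ with $l(t)=a$ and $m\xRightarrow{\sigma}m''\xrightarrow{t}m'$. $(N,C)$ is a coherent net if for every $m\models C$, $\sigma\in\Sigma^*$, $m\xRightarrow{\sigma}m'$ there is $m''\models C$ with $m\overset{\sigma}{\twoheadrightarrow}m''$ and $m''\xRightarrow{\epsilon}m'$. For a net $N$: $\mathrm{ENBL}_t(\vec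 x)\triangleq\bigwedge_i x_i\ge\mathrm{Pre}(t,p_i)$; $\Delta_t(\vec x,\vec x')\triangleq\bigwedge_i x_i'=x_i+\mathrm{Post}(t,p_i)-\mathrm{Pre}(t,p_i)$; $T(\vec x,\vec x',a)\triangleq\bigvee_{t\in T,\,l(t)\ne\tau}(\mathrm{ENBL}_t\wedge\Delta_t\wedge a=l(t))$; $\tau(\vec x,\vec x')\triangleq\bigvee_{t\in T,\,l(t)=\tau}(\mathrm{ENBL}_t(\vec x)\wedge\Delta_t(\vec x,\vec x'))$ ($\tau_1$ is this formula for $N_1$); $\overleftarrow{T}_C(\vec x,\vec x',a)\triangleq\exists\vec x''.\tau^*_C(\vec x,\vec x'')\wedge T(\vec x'',\vec x',a)$; $\hat T_C(\vec x,\vec x',a)\triangleq(\exists\vec x_1.\overleftarrow{T}_C(\vec x,\vec x_1,a)\wedge C(\vec x_1)\wedge\tau^*_C(\vec x_1,\vec x'))\vee(a=0\wedge\tau^*_C(\vec x,\vec x'))$. All variables range over $\mathbb N$ and "valid" means true for all assignments. $\tilde E(\vec x,\vec y)$ is $E$ with places of $N_1$ replaced by variables $\vec x$, places of $N_2$ replaced by $\vec y$ (bound variables renamed apart), conjoined with $x_i=y_j$ whenever place $p^1_i$ of $N_1$ equals place $p^2_j$ of $N_2$. For markings $m_1,m_2$, $m_1\equiv_E m_2$ means $\tilde E(m_1,m_2)$ holds, and $m_1\langle C_1EC_2\rangle m_2$ means $m_1\models C_1$, $m_1\equiv_E m_2$, $m_2\models C_2$. $(N_1,C_1)\preceq_E(N_2,C_2)$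 means: (S1) for every $m_1\models C_1$ there is $m_2$ with $m_1\langle C_1EC_2\rangle m_2$; (S2) for all $m_1\xRightarrow{\epsilon}m_1'$ in $N_1$ and all $m_2$, $m_1\equiv_E m_2$ implies $m_1'\equiv_E m_2$; (S3) for all $\sigma\in\Sigma^*$, $m_1\xRightarrow{\sigma}m_1'$ in $N_1$ and $m_2,m_2'$ with $m_1\langle C_1EC_2\rangle m_2$ and $m_1'\equiv_E m_2'$, we have $m_2\xRightarrow{\sigma}m_2'$ in $N_2$. -}

module Defs where

open import Data.Nat using (ℕ; zero; suc; _+_; _∸_; _≤_)
open import Data.Fin using (Fin)
open import Data.Vec using (Vec; lookup)
open import Data.List using (List; []; _∷_; map; _∷ʳ_)
open import Data.Product using (Σ; _×_; _,_; ∃; ∃-syntax)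
open import Data.Sum using (_⊎_)
open import Relation.Binary.PropositionalEquality using (_≡_; _≢_)
open import Function.Bundles using (_⇔_)
open import Function.Definitions using (Injective)

-- Places are drawn from a common universe `Place` (so that places of two
-- nets can be compared); a net has n places, named injectively by
-- `place`, and k transitions.  Labels are natural numbers, 0 encodes τ.

record Net (Place : Set) : Set where
  field
    n        : ℕ
    k        : ℕ
    place    : Fin n → Place
    placeInj : Injective _≡_ _≡_ place
    Pre      : Fin k → Fin n → ℕ
    Post     : Fin k → Fin n → ℕ
    label    : Fin k → ℕ

open Net public

Marking : ∀ {Place} → Net Place → Set
Marking N = Vec ℕ (n N)

-- semantic "formula" over markings of N (a predicate on vectors)
Pred : ∀ {Place} → Net Place → Set₁
Pred N = Marking N → Set

Rel : ∀ {Place} → Net Place → Set₁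
Rel N = Marking N → Marking N → Set

module _ {Place : Set} (N : Net Place) where

  Enabled : Marking N → Fin (k N) → Set
  Enabled m t = ∀ i → Pre N t i ≤ lookup m i

  Step : Marking N → Fin (k N) → Marking N → Set
  Step m t m' = Enabled m t × (∀ i → lookup m' i ≡ (lookup m i ∸ Pre N t i) + Post N t i)

  data Fires : Marking N → List (Fin (k N)) → Marking N → Set where
    fires-[] : ∀ {m} → Fires m [] m
    fires-∷  : ∀ {m m' m'' t ϱ} → Step m t m' → Fires m' ϱ m'' → Fires m (t ∷ ϱ) m''

  erase : List ℕ → List ℕ
  erase []            = []
  erase (zero ∷ xs)   = erase xs
  erase (suc a ∷ xs)  = suc a ∷ erase xs

  WeakReach : Marking N → List ℕ → Marking N → Set
  WeakReach m σ m' = Σ (List (Fin (k N))) λ ϱ → Fires m ϱ m' × erase (map (label N) ϱ) ≡ σ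

  Silent : Marking N → Marking N → Set
  Silent m m' = WeakReach m [] m'

  data Arrow : Marking N → List ℕ → Marking N → Set where
    arrow-ε    : ∀ {m} → Arrow m [] m
    arrow-snoc : ∀ {m m'' m' σ a} (t : Fin (k N)) →
                 a ≢ 0 → label N t ≡ a →
                 WeakReach m σ m'' → Step m'' t m' → Arrow m (σ ∷ʳ a) m'

  Coherent : Pred N → Set
  Coherent C = ∀ m σ m' → C m → WeakReach m σ m' →
               Σ (Marking N) λ m'' → C m'' × Arrow m σ m'' × Silent m'' m'

  ENBL : Fin (k N) → Marking N → Set
  ENBL t x = ∀ i → Pre N t i ≤ lookup x i

  Δ : Fin (k N) → Marking N → Marking N → Set
  Δ t x x' = ∀ i → lookup x' i + Pre N t i ≡ lookup x i + Post N t i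

  TF : Marking N → Marking N → ℕ → Set
  TF x x' a = Σ (Fin (k N)) λ t → label N t ≢ 0 × ENBL t x × Δ t x x' × a ≡ label N t

  τF : Marking N → Marking N → Set
  τF x x' = Σ (Fin (k N)) λ t → label N t ≡ 0 × ENBL t x × Δ t x x'

  CharacterisesSilent : Pred N → Rel N → Set
  CharacterisesSilent C τ* = ∀ m m' → C m → (τ* m m' ⇔ Silent m m')

  TL : Rel N → Marking N → Marking N → ℕ → Set
  TL τ* x x' a = Σ (Marking N) λ x'' → τ* x x'' × TF x'' x' a

  That : Pred N → Rel N → Marking N → Marking N → ℕ → Set
  That C τ* x x' a =
    (Σ (Marking N) λ x₁ → TL τ* x x₁ a × C x₁ × τ* x₁ x')
    ⊎ (a ≡ 0 × τ* x x')

  Core0 : Pred N → Rel N → Set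
  Core0 C τ* = ∀ p p' a → C p → TL τ* p p' a →
               Σ (Marking N) λ p'' → C p'' × TL τ* p p'' a × τ* p'' p'

module _ {Place : Set} (N₁ N₂ : Net Place) where

  Etilde : (Marking N₁ → Marking N₂ → Set) → Marking N₁ → Marking N₂ → Set
  Etilde E x y = E x y × (∀ i j → place N₁ i ≡ place N₂ j → lookup x i ≡ lookup y j)

  Simulates : Pred N₁ → (Marking N₁ → Marking N₂ → Set) → Pred N₂ → Set
  Simulates C₁ E C₂ =
    (∀ m₁ → C₁ m₁ → Σ (Marking N₂) λ m₂ → C₁ m₁ × Etilde E m₁ m₂ × C₂ m₂)
    × (∀ m₁ m₁' m₂ → Silent N₁ m₁ m₁' → Etilde E m₁ m₂ → Etilde E m₁' m₂)
    × (∀ σ m₁ m₁' m₂ m₂' → WeakReach N₁ m₁ σ m₁' →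
         (C₁ m₁ × Etilde E m₁ m₂ × C₂ m₂) → Etilde E m₁' m₂' →
         WeakReach N₂ m₂ σ m₂')

-- A run of a net alternates maximal silent stretches with visible steps.
-- Core 0 lets every "silent stretch, then visible step" leaving a
-- C-marking be rerouted through a C-marking followed by silent moves; doing
-- this step by step gives coherence.  For the simulation, Core 2 makes Ẽ
-- invariant under silent moves of N₁, and a run of N₁ from a C₁-marking is
-- cut the same way into T̂_{C₁}-steps between C₁-markings; Core 1 supplies a
-- C₂-partner for each intermediate C₁-marking and Core 3 turns each such
-- step into a T̂_{C₂}-step of N₂.

module Submission where

open import Defs
open import Data.Nat using (ℕ; zero; suc; _+_; _∸_; _≤_)
open import Data.Nat.Properties using (+-∸-comm; m+n∸n≡m; m∸n+n≡m; m≤m+n; ≤-trans; 1+n≢0)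
open import Data.List using ([]; _∷_; map; _++_; _∷ʳ_)
open import Data.List.Properties using (map-++; ++-assoc; ++-identityʳ)
open import Data.Product using (Σ; _×_; _,_; proj₁)
open import Data.Sum using (inj₁; inj₂)
open import Data.Empty using (⊥-elim)
open import Function.Bundles using (Equivalence)
open import Relation.Binary.PropositionalEquality
open ≡-Reasoning

m≡n∸o+p⇒m+o≡n+p : ∀ {m n o p} → o ≤ n → m ≡ n ∸ o + p → m + o ≡ n + p
m≡n∸o+p⇒m+o≡n+p {m} {n} {o} {p} o≤n m≡n∸o+p = begin
  m + o            ≡⟨ cong (_+ o) m≡n∸o+p ⟩
  n ∸ o + p + o    ≡⟨ cong (_+ o) (+-∸-comm p o≤n) ⟨
  n + p ∸ o + o    ≡⟨ m∸n+n≡m (≤-trans o≤n (m≤m+n n p)) ⟩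
  n + p            ∎

m+o≡n+p⇒m≡n∸o+p : ∀ {m n o p} → o ≤ n → m + o ≡ n + p → m ≡ n ∸ o + p
m+o≡n+p⇒m≡n∸o+p {m} {n} {o} {p} o≤n m+o≡n+p = begin
  m            ≡⟨ m+n∸n≡m m o ⟨
  m + o ∸ o    ≡⟨ cong (_∸ o) m+o≡n+p ⟩
  n + p ∸ o    ≡⟨ +-∸-comm p o≤n ⟩
  n ∸ o + p    ∎

module Semantics {Place : Set} (N : Net Place) where

  Step⇒Δ : ∀ m {t} m' → Step N m t m' → Δ N t m m'
  Step⇒Δ _ _ (en , eq) i = m≡n∸o+p⇒m+o≡n+p (en i) (eq i)

  ENBL×Δ⇒Step : ∀ m {t} m' → ENBL N t m → Δ N t m m' → Step N m t m'
  ENBL×Δ⇒Step _ _ en d = en , λ i → m+o≡n+p⇒m≡n∸o+p (en i) (d i)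

  erase-++ : ∀ xs ys → erase N (xs ++ ys) ≡ erase N xs ++ erase N ys
  erase-++ []           ys = refl
  erase-++ (zero ∷ xs)  ys = erase-++ xs ys
  erase-++ (suc a ∷ xs) ys = cong (suc a ∷_) (erase-++ xs ys)

  erase-visible : ∀ {a} xs → a ≢ 0 → erase N (a ∷ xs) ≡ a ∷ erase N xs
  erase-visible {zero}  xs a≢0 = ⊥-elim (a≢0 refl)
  erase-visible {suc a} xs a≢0 = refl

  Fires-++ : ∀ {m ϱ m' ϱ' m''} → Fires N m ϱ m' → Fires N m' ϱ' m'' → Fires N m (ϱ ++ ϱ') m''
  Fires-++ fires-[]       f' = f'
  Fires-++ (fires-∷ s f)  f' = fires-∷ s (Fires-++ f f')

  WeakReach-refl : ∀ {m} → Silent N m m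
  WeakReach-refl = [] , fires-[] , refl

  WeakReach-++ : ∀ {m σ m' σ' m''} → WeakReach N m σ m' → WeakReach N m' σ' m'' →
                 WeakReach N m (σ ++ σ') m''
  WeakReach-++ (ϱ , f , refl) (ϱ' , f' , refl) = ϱ ++ ϱ' , Fires-++ f f' , (begin
    erase N (map (label N) (ϱ ++ ϱ'))                      ≡⟨ cong (erase N) (map-++ (label N) ϱ ϱ') ⟩
    erase N (map (label N) ϱ ++ map (label N) ϱ')          ≡⟨ erase-++ (map (label N) ϱ) (map (label N) ϱ') ⟩
    erase N (map (label N) ϱ) ++ erase N (map (label N) ϱ') ∎)

  WeakReach-Silent : ∀ {m σ m' m''} → WeakReach N m σ m' → Silent N m' m'' → WeakReach N m σ m''
  WeakReach-Silent {m} {σ} {m'' = m''} w s =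
    subst (λ σ' → WeakReach N m σ' m'') (++-identityʳ σ) (WeakReach-++ w s)

  Step⇒WeakReach : ∀ {m t m'} → Step N m t m' → WeakReach N m (erase N (label N t ∷ [])) m'
  Step⇒WeakReach {t = t} s = t ∷ [] , fires-∷ s fires-[] , refl

  Silent-τ-snoc : ∀ {m m' t m''} → Silent N m m' → Step N m' t m'' → label N t ≡ 0 → Silent N m m''
  Silent-τ-snoc {m' = m'} {m'' = m''} s st lt≡0 =
    WeakReach-++ s (subst (λ l → WeakReach N m' (erase N (l ∷ [])) m'') lt≡0 (Step⇒WeakReach st))

  Arrow⇒WeakReach : ∀ {m σ m'} → Arrow N m σ m' → WeakReach N m σ m'
  Arrow⇒WeakReach arrow-ε = WeakReach-refl
  Arrow⇒WeakReach {m} {m' = m'} (arrow-snoc {σ = σ} t a≢0 refl w s) =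
    subst (λ σ' → WeakReach N m (σ ++ σ') m') (erase-visible [] a≢0) (WeakReach-++ w (Step⇒WeakReach s))

  Silent-preserves : (P : Marking N → Set) → (∀ {x x'} → P x → τF N x x' → P x') →
                     ∀ {m m'} → Silent N m m' → P m → P m'
  Silent-preserves P τF-preserves (ϱ , f , ϱ-silent) = Fires-preserves f ϱ-silent
    where
      Fires-preserves : ∀ {m ϱ m'} → Fires N m ϱ m' → erase N (map (label N) ϱ) ≡ [] → P m → P m'
      Fires-preserves fires-[] _ p = p
      Fires-preserves (fires-∷ {m} {m'} {t = t} st f) ϱ-silent p with label N t in lt≡0
      ... | zero  = Fires-preserves f ϱ-silent (τF-preserves p (t , lt≡0 , proj₁ st , Step⇒Δ m m' st))
      ... | suc _ with () ← ϱ-silent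

module Characterised {Place : Set} (N : Net Place) (C : Pred N) (τ* : Rel N)
                     (τ*-correct : CharacterisesSilent N C τ*) where

  open Semantics N

  τ*⇒Silent : ∀ {m m'} → C m → τ* m m' → Silent N m m'
  τ*⇒Silent {m} {m'} c = Equivalence.to (τ*-correct m m' c)

  Silent⇒τ* : ∀ {m m'} → C m → Silent N m m' → τ* m m'
  Silent⇒τ* {m} {m'} c = Equivalence.from (τ*-correct m m' c)

  TL⇒WeakReach : ∀ {x p a} → C x → TL N τ* x p a → WeakReach N x (erase N (a ∷ [])) p
  TL⇒WeakReach {p = p} cx (x' , τx , t , _ , en , d , refl) =
    WeakReach-++ (τ*⇒Silent cx τx) (Step⇒WeakReach (ENBL×Δ⇒Step x' p en d))

  That⇒WeakReach : ∀ {x x' a} → C x → That N C τ* x x' a → WeakReach N x (erase N (a ∷ [])) x'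
  That⇒WeakReach cx (inj₁ (x₁ , tl , cx₁ , τx₁)) = WeakReach-Silent (TL⇒WeakReach cx tl) (τ*⇒Silent cx₁ τx₁)
  That⇒WeakReach cx (inj₂ (refl , τx))           = τ*⇒Silent cx τx

  Arrow-snoc-TL : ∀ {m σ x p a} → C x → Arrow N m σ x → TL N τ* x p a → Arrow N m (σ ∷ʳ a) p
  Arrow-snoc-TL {p = p} cx ar (x' , τx , t , lt≢0 , en , d , refl) =
    arrow-snoc t lt≢0 refl (WeakReach-Silent (Arrow⇒WeakReach ar) (τ*⇒Silent cx τx)) (ENBL×Δ⇒Step x' p en d)

  module _ (core0 : Core0 N C τ*) where

    reroute-visible : ∀ {x y t y' a} → C x → Silent N x y → Step N y t y' → label N t ≡ suc a →
                      Σ (Marking N) λ p → C p × TL N τ* x p (suc a) × τ* p y'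
    reroute-visible {x} {y} {t} {y'} {a} cx s st lt≡1+a =
      core0 x y' (suc a) cx
        (y , Silent⇒τ* cx s , t , (λ lt≡0 → 1+n≢0 (trans (sym lt≡1+a) lt≡0)) , proj₁ st , Step⇒Δ y y' st , sym lt≡1+a)

    coherent-from : ∀ ϱ {m σ x y m'} → C x → Arrow N m σ x → Silent N x y → Fires N y ϱ m' →
                    Σ (Marking N) λ m'' → C m'' × Arrow N m (σ ++ erase N (map (label N) ϱ)) m'' × Silent N m'' m'
    coherent-from [] {m} {σ} {x} cx ar s fires-[] =
      x , cx , subst (λ σ' → Arrow N m σ' x) (sym (++-identityʳ σ)) ar , s
    coherent-from (t ∷ ϱ) cx ar s (fires-∷ st f) with label N t in lt≡
    ... | zero  = coherent-from ϱ cx ar (Silent-τ-snoc s st lt≡) f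
    ... | suc a with reroute-visible cx s st lt≡
    ...   | p , cp , tl , τp with coherent-from ϱ cp (Arrow-snoc-TL cx ar tl) (τ*⇒Silent cp τp) f
    ...     | m'' , cm'' , ar' , s' = m'' , cm'' , subst (λ σ' → Arrow N _ σ' m'') (++-assoc _ (suc a ∷ []) _) ar' , s'

    Core0⇒Coherent : Coherent N C
    Core0⇒Coherent m _ m' cm (ϱ , f , refl) = coherent-from ϱ cm arrow-ε WeakReach-refl f

module Simulation {Place : Set} (N₁ N₂ : Net Place) (C₁ : Pred N₁) (C₂ : Pred N₂)
                  (E : Marking N₁ → Marking N₂ → Set) (τ*₁ : Rel N₁) (τ*₂ : Rel N₂)
                  (τ*₁-correct : CharacterisesSilent N₁ C₁ τ*₁)
                  (τ*₂-correct : CharacterisesSilent N₂ C₂ τ*₂)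
                  (core0₁ : Core0 N₁ C₁ τ*₁)
                  (core1 : ∀ x → C₁ x → Σ (Marking N₂) λ y → Etilde N₁ N₂ E x y × C₂ y)
                  (core3 : ∀ p₁ p₂ (a : ℕ) p₁' p₂' → C₁ p₁ → Etilde N₁ N₂ E p₁ p₂ → C₂ p₂ →
                           That N₁ C₁ τ*₁ p₁ p₁' a → Etilde N₁ N₂ E p₁' p₂' → That N₂ C₂ τ*₂ p₂ p₂' a)
                  where

  private
    Ẽ : Marking N₁ → Marking N₂ → Set
    Ẽ = Etilde N₁ N₂ E
    module K₁ = Characterised N₁ C₁ τ*₁ τ*₁-correct
    module K₂ = Characterised N₂ C₂ τ*₂ τ*₂-correct
    module S₁ = Semantics N₁
    module S₂ = Semantics N₂

  simulate-from : ∀ ϱ {x y z m₁' m₂'} → C₁ x → Ẽ x y → C₂ y → Silent N₁ x z → Fires N₁ z ϱ m₁' → Ẽ m₁' m₂' →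
                  WeakReach N₂ y (erase N₁ (map (label N₁) ϱ)) m₂'
  simulate-from [] {x} {y} {m₁' = m₁'} {m₂'} cx e cy s fires-[] e' =
    K₂.That⇒WeakReach cy (core3 x y 0 m₁' m₂' cx e cy (inj₂ (refl , K₁.Silent⇒τ* cx s)) e')
  simulate-from (t ∷ ϱ) cx e cy s (fires-∷ st f) e' with label N₁ t in lt≡
  ... | zero  = simulate-from ϱ cx e cy (S₁.Silent-τ-snoc s st lt≡) f e'
  ... | suc a with K₁.reroute-visible core0₁ cx s st lt≡
  ...   | p , cp , tl , τp with core1 p cp
  ...     | q , e'' , cq =
    S₂.WeakReach-++ (K₂.That⇒WeakReach cy (core3 _ _ (suc a) p q cx e cy (inj₁ (p , tl , cp , K₁.Silent⇒τ* cp S₁.WeakReach-refl)) e''))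
                    (simulate-from ϱ cp e'' cq (K₁.τ*⇒Silent cp τp) f e')

  simulate : ∀ σ m₁ m₁' m₂ m₂' → WeakReach N₁ m₁ σ m₁' → (C₁ m₁ × Ẽ m₁ m₂ × C₂ m₂) → Ẽ m₁' m₂' →
             WeakReach N₂ m₂ σ m₂'
  simulate _ _ _ _ _ (ϱ , f , refl) (c₁ , e , c₂) e' = simulate-from ϱ c₁ e c₂ S₁.WeakReach-refl f e'

theorem3 : {Place : Set} (N₁ N₂ : Net Place)
    (C₁ : Pred N₁) (C₂ : Pred N₂)
    (E : Marking N₁ → Marking N₂ → Set)
    (τ*₁ : Rel N₁) (τ*₂ : Rel N₂) →
    CharacterisesSilent N₁ C₁ τ*₁ →
    CharacterisesSilent N₂ C₂ τ*₂ →
    Core0 N₁ C₁ τ*₁ →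
    Core0 N₂ C₂ τ*₂ →
    (∀ x → C₁ x → Σ (Marking N₂) λ y → Etilde N₁ N₂ E x y × C₂ y) →
    (∀ p₁ p₂ p₁' → Etilde N₁ N₂ E p₁ p₂ → τF N₁ p₁ p₁' → Etilde N₁ N₂ E p₁' p₂) →
    (∀ p₁ p₂ (a : ℕ) p₁' p₂' → C₁ p₁ → Etilde N₁ N₂ E p₁ p₂ → C₂ p₂ →
    That N₁ C₁ τ*₁ p₁ p₁' a → Etilde N₁ N₂ E p₁' p₂' → That N₂ C₂ τ*₂ p₂ p₂' a) →
    Coherent N₁ C₁ × Coherent N₂ C₂ × Simulates N₁ N₂ C₁ E C₂
theorem3 N₁ N₂ C₁ C₂ E τ*₁ τ*₂ ch₁ ch₂ core0₁ core0₂ core1 core2 core3 =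
  K₁.Core0⇒Coherent core0₁ , K₂.Core0⇒Coherent core0₂ , s1 , s2 ,
  Simulation.simulate N₁ N₂ C₁ C₂ E τ*₁ τ*₂ ch₁ ch₂ core0₁ core1 core3
  where
    module K₁ = Characterised N₁ C₁ τ*₁ ch₁
    module K₂ = Characterised N₂ C₂ τ*₂ ch₂
    Ẽ : Marking N₁ → Marking N₂ → Set
    Ẽ = Etilde N₁ N₂ E

    s1 : ∀ m₁ → C₁ m₁ → Σ (Marking N₂) λ m₂ → C₁ m₁ × Ẽ m₁ m₂ × C₂ m₂
    s1 m₁ c₁ = let (m₂ , e , c₂) = core1 m₁ c₁ in m₂ , c₁ , e , c₂

    s2 : ∀ m₁ m₁' m₂ → Silent N₁ m₁ m₁' → Ẽ m₁ m₂ → Ẽ m₁' m₂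
    s2 _ _ m₂ = Semantics.Silent-preserves N₁ (λ x → Ẽ x m₂) (λ {x} {x'} → core2 x m₂ x')
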